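{- Let $h\in\mathbb N$ and $i\in[h-1]$. Let $u,v\in\mathfrak S_n$ with $u<v$, and let $F$ be an $h$-flipclass of paths from $u$ to $v$. Then for any two vertices $\bar x=(x,i-1)$ and $\bar y=(y,i+1)$ of $TS_F$, the number of directed paths of length $2$ from $\bar x$ to $\bar y$ in $TS_F$ is $0$, $1$ or $2$.
   Context: $\mathfrak S_n$: symmetric group on $[n]$, $\ell$ Coxeter length, $T$ transpositions. Bruhat graph: edge $x\xrightarrow{t}y$ whenever $yx^{ -1}=t\in T$ and $\ell(x)<\ell(y)$; $u<v$ in Bruhat order means $u\neq v$ and there is a directed path from $u$ to $v$. $P_h(u,v)$: directed paths of length $h$ from $u$ to $v$. Between two elements there are 0 or 2 paths of length 2, each the flip of the other; $f_i$ replaces the subpath $x_{i-1}\to x_i\to x_{i+1}$ by its flip; the $h$-flipclasses of paths from $u$ to $v$ are the orbits of the group generated by $f_1,\dots,f_{h-1}$ on $P_h(u,v)$. The time-support graph $TS_F$ has vertex set $\{(a,j):\exists(x_0\to\cdots\to x_h)\in F, x_j=a\}$ and an edge $(a,j)\to(b,j+1)$ whenever some path of $F$ has $x_j=a$, $x_{j+1}=b$. -}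

module Defs where

open import Data.Nat using (ℕ; zero; suc; _<_; _≤_; _<ᵇ_; _∸_)
open import Data.Fin using (Fin; toℕ; _≟_)
open import Data.Vec using (Vec; []; _∷_; lookup; map)
open import Data.List using (List; allFin) renaming (map to mapL)
open import Data.Nat.ListAction using (sum)
open import Data.Bool using (if_then_else_; _∧_)
open import Data.Product using (Σ; _×_; ∃; ∃-syntax)
open import Relation.Nullary using (¬_; yes; no)
open import Relation.Binary.PropositionalEquality using (_≡_)
open import Relation.Binary.Construct.Closure.ReflexiveTransitive using (Star)

-- Elements of 𝔖ₙ in one-line notation: x(k) = lookup x k.
Perm : ℕ → Set
Perm n = Vec (Fin n) n

IsPerm : ∀ {n} → Perm n → Set
IsPerm {n} x = ∀ (a b : Fin n) → lookup x a ≡ lookup x b → a ≡ b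

-- Coxeter length of a permutation = number of inversions.
ℓ : ∀ {n} → Perm n → ℕ
ℓ {n} x = sum (mapL (λ a → sum (mapL (λ b →
            if (toℕ a <ᵇ toℕ b) ∧ (toℕ (lookup x b) <ᵇ toℕ (lookup x a))
            then 1 else 0) (allFin n))) (allFin n))

swap : ∀ {n} → Fin n → Fin n → Fin n → Fin n
swap a b k with k ≟ a
... | yes _ = b
... | no _ with k ≟ b
...   | yes _ = a
...   | no _ = k

-- Left multiplication t ∘ x by the transposition t = (a b).
tmul : ∀ {n} → Fin n → Fin n → Perm n → Perm n
tmul a b x = map (swap a b) x

Edge : ∀ {n} → Perm n → Perm n → Set
Edge {n} x y = Σ (Fin n) λ a → Σ (Fin n) λ b →
  (¬ a ≡ b) × (y ≡ tmul a b x) × (ℓ x < ℓ y)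

BruhatLt : ∀ {n} → Perm n → Perm n → Set
BruhatLt u v = (¬ u ≡ v) × Star Edge u v

-- Total lookup into a sequence x₀,…,x_h (clamped beyond h; only used for j ≤ h).
at : ∀ {A : Set} {h} → Vec A (suc h) → ℕ → A
at (x ∷ []) _ = x
at (x ∷ y ∷ ys) zero = x
at (x ∷ y ∷ ys) (suc j) = at (y ∷ ys) j

IsPath : ∀ {n} h → Perm n → Perm n → Vec (Perm n) (suc h) → Set
IsPath h u v p = (at p 0 ≡ u) × (at p h ≡ v) ×
  (∀ j → j < h → Edge (at p j) (at p (suc j)))

-- q = fᵢ(p) for p, q ∈ P_h(u,v): q differs from p exactly at position i
-- (x_{i-1} → x_i → x_{i+1} replaced by the other length-2 path).
FlipAt : ∀ {n} h → Perm n → Perm n → ℕ → Vec (Perm n) (suc h) → Vec (Perm n) (suc h) → Set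
FlipAt h u v i p q = IsPath h u v p × IsPath h u v q ×
  (∀ j → j ≤ h → ¬ j ≡ i → at q j ≡ at p j) × (¬ at q i ≡ at p i)

FlipStep : ∀ {n} h → Perm n → Perm n → Vec (Perm n) (suc h) → Vec (Perm n) (suc h) → Set
FlipStep h u v p q = ∃[ i ] (1 ≤ i) × (suc i ≤ h) × FlipAt h u v i p q

-- The h-flipclass F of p₀ ∈ P_h(u,v): its orbit under ⟨f₁,…,f_{h-1}⟩
-- (each fᵢ is an involution, so the orbit is the reflexive-transitive closure).
InFlipClass : ∀ {n} h → Perm n → Perm n → Vec (Perm n) (suc h) → Vec (Perm n) (suc h) → Set
InFlipClass h u v p₀ q = Star (FlipStep h u v) p₀ q

TSVertex : ∀ {n} h → Perm n → Perm n → Vec (Perm n) (suc h) → Perm n → ℕ → Set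
TSVertex h u v p₀ a j = (j ≤ h) × ∃[ q ] InFlipClass h u v p₀ q × (at q j ≡ a)

TSEdge : ∀ {n} h → Perm n → Perm n → Vec (Perm n) (suc h) → Perm n → ℕ → Perm n → ℕ → Set
TSEdge h u v p₀ a j b k = (k ≡ suc j) × (suc j ≤ h) ×
  ∃[ q ] InFlipClass h u v p₀ q × (at q j ≡ a) × (at q (suc j) ≡ b)

-- (b,i) is the middle vertex of a directed length-2 path (x,i-1) → (b,i) → (y,i+1) in TS_F.
-- (Every such path has this shape, since TS_F edges raise time by exactly 1.)
TSMiddle : ∀ {n} h → Perm n → Perm n → Vec (Perm n) (suc h) → ℕ → Perm n → Perm n → Perm n → Set
TSMiddle h u v p₀ i x y b = TSEdge h u v p₀ x (i ∸ 1) b i × TSEdge h u v p₀ b i y (suc i)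

module Submission where

-- A path x → b → y in the Bruhat graph has b = t x and y = s b for transpositions t, s, so
-- y = W x with W = s t the same for every middle vertex b. A product W ≠ id of two transpositions
-- is either a product of two disjoint transpositions, which are then its only right factors, so at
-- most two middle vertices exist; or a 3-cycle (p q r), whose right factors give the candidates
-- (p q) x, (q r) x, (r p) x. Left multiplication by (a c) with a < c raises the length only if a
-- stands left of c in x; if all three candidates were middle vertices, the resulting position
-- orders would make each of p, q, r the largest or the smallest of the three.
-- The middle vertices of TS_F form a finite list because F is the reachable set of the finite
-- flip graph, whose edges are decidable.

open import Defs
open import Data.Bool using (Bool; true; false; T; _∧_; if_then_else_)
open import Data.Bool.Properties using (∧-zeroʳ)
open import Data.Empty using (⊥; ⊥-elim)
open import Data.Fin as Fin using (Fin; toℕ)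
open import Data.Fin.Properties as Finₚ using ()
open import Data.List using (List; []; _∷_; [_]; length; filter; cartesianProductWith; deduplicate; allFin) renaming (map to mapL)
open import Data.List.Properties using (map-tabulate; filter-notAll)
open import Data.List.Membership.Propositional using (_∈_; find; lose)
open import Data.List.Membership.Propositional.Properties using (∈-filter⁺; ∈-filter⁻; ∈-deduplicate⁺; ∈-cartesianProductWith⁺; ∈-allFin)
open import Data.List.Relation.Unary.All using (_∷_)
open import Data.List.Relation.Unary.AllPairs using (_∷_)
open import Data.List.Relation.Unary.Any as Any using (here; there; any?)
open import Data.List.Relation.Unary.Unique.Propositional using (Unique)
open import Data.List.Relation.Unary.Unique.Propositional.Properties using (filter⁺)
open import Data.List.Relation.Unary.Unique.DecPropositional.Properties using (deduplicate-!)
open import Data.Nat as ℕ using (ℕ; zero; suc; _+_; _≤_; _<_; _∸_; _<ᵇ_; z≤n; s≤s)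
open import Data.Nat.ListAction using (sum)
open import Data.Nat.Properties as ℕₚ using ()
open import Algebra.Properties.CommutativeSemigroup ℕₚ.+-commutativeSemigroup using (interchange; x∙yz≈y∙xz)
open import Data.Product using (∃; ∃₂; ∃-syntax; _×_; _,_; proj₁; proj₂)
open import Data.Sum as Sum using (_⊎_; inj₁; inj₂)
open import Data.Unit using (tt)
open import Data.Vec using (Vec; []; _∷_; lookup; map)
open import Data.Vec.Functional using (updateAt)
open import Data.Vec.Functional.Properties using (updateAt-updates; updateAt-minimal)
open import Data.Vec.Properties using (lookup-map; map-cong; map-∘; map-id; ≡-dec)
open import Function using (_∘_; id; const; flip)
open import Function.Bundles using (_⇔_; mk⇔; Equivalence)
open import Relation.Binary.Construct.Closure.ReflexiveTransitive using (Star; ε; _◅_; _◅◅_)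
open import Relation.Binary.Definitions using (DecidableEquality; tri<; tri≈; tri>)
open import Relation.Binary.PropositionalEquality hiding ([_])
open import Relation.Nullary using (¬_; Dec; yes; no; ¬?)
open import Relation.Nullary.Decidable using (_×-dec_; _→-dec_; map′)

private
  variable
    n : ℕ

swap-fst : (a b : Fin n) → swap a b a ≡ b
swap-fst a b with a Fin.≟ a
... | yes _ = refl
... | no a≢a = ⊥-elim (a≢a refl)

swap-snd : (a b : Fin n) → swap a b b ≡ a
swap-snd a b with b Fin.≟ a
... | yes b≡a = b≡a
... | no _ with b Fin.≟ b
...   | yes _ = refl
...   | no b≢b = ⊥-elim (b≢b refl)

swap-other : ∀ {a b k : Fin n} → k ≢ a → k ≢ b → swap a b k ≡ k
swap-other {a = a} {b} {k} k≢a k≢b with k Fin.≟ a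
... | yes k≡a = ⊥-elim (k≢a k≡a)
... | no _ with k Fin.≟ b
...   | yes k≡b = ⊥-elim (k≢b k≡b)
...   | no _ = refl

swap-involutive : (a b : Fin n) → swap a b ∘ swap a b ≗ id
swap-involutive a b k with k Fin.≟ a
... | yes refl = swap-snd k b
... | no k≢a with k Fin.≟ b
...   | yes refl = swap-fst a k
...   | no k≢b = swap-other k≢a k≢b

swap-comm : (a b : Fin n) → swap a b ≗ swap b a
swap-comm a b k = by-cases (k Fin.≟ a) (k Fin.≟ b)
  where
  by-cases : Dec (k ≡ a) → Dec (k ≡ b) → swap a b k ≡ swap b a k
  by-cases (yes refl) (yes refl) = refl
  by-cases (yes refl) (no _) = trans (swap-fst k b) (sym (swap-snd b k))
  by-cases (no _) (yes refl) = trans (swap-snd a k) (sym (swap-fst k a))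
  by-cases (no k≢a) (no k≢b) = trans (swap-other k≢a k≢b) (sym (swap-other k≢b k≢a))

swap-injective : ∀ {k l} (a b : Fin n) → swap a b k ≡ swap a b l → k ≡ l
swap-injective {k = k} {l} a b eq = begin
  k                     ≡⟨ swap-involutive a b k ⟨
  swap a b (swap a b k) ≡⟨ cong (swap a b) eq ⟩
  swap a b (swap a b l) ≡⟨ swap-involutive a b l ⟩
  l                     ∎
  where open ≡-Reasoning

swap-moved : ∀ {k} (a b : Fin n) → swap a b k ≢ k → k ≡ a ⊎ k ≡ b
swap-moved {k = k} a b moved = by-cases (k Fin.≟ a) (k Fin.≟ b)
  where
  by-cases : Dec (k ≡ a) → Dec (k ≡ b) → k ≡ a ⊎ k ≡ b
  by-cases (yes k≡a) _ = inj₁ k≡a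
  by-cases (no _) (yes k≡b) = inj₂ k≡b
  by-cases (no k≢a) (no k≢b) = ⊥-elim (moved (swap-other k≢a k≢b))

swap-determined : ∀ {u} (d e : Fin n) → u ≢ swap d e u → swap d e ≗ swap u (swap d e u)
swap-determined {u = u} d e moved k with swap-moved d e (moved ∘ sym)
... | inj₁ refl rewrite swap-fst u e = refl
... | inj₂ refl rewrite swap-snd d u = swap-comm d u k

tmul-cong : ∀ {a b c d : Fin n} → swap a b ≗ swap c d → (x : Perm n) → tmul a b x ≡ tmul c d x
tmul-cong = map-cong

tmul-at : (a c : Fin n) (x : Perm n) {k v : Fin n} → lookup x k ≡ v → lookup (tmul a c x) k ≡ swap a c v
tmul-at a c x {k} xk≡v = trans (lookup-map k (swap a c) x) (cong (swap a c) xk≡v)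

tmul-involutive : (a b : Fin n) (x : Perm n) → tmul a b (tmul a b x) ≡ x
tmul-involutive a b x = begin
  map (swap a b) (map (swap a b) x) ≡⟨ map-∘ (swap a b) (swap a b) x ⟨
  map (swap a b ∘ swap a b) x       ≡⟨ map-cong (swap-involutive a b) x ⟩
  map id x                          ≡⟨ map-id x ⟩
  x                                 ∎
  where open ≡-Reasoning

tmul-IsPerm : (a b : Fin n) (x : Perm n) → IsPerm x → IsPerm (tmul a b x)
tmul-IsPerm a b x x-perm k m eq = x-perm k m (swap-injective a b (begin
  swap a b (lookup x k)     ≡⟨ lookup-map k (swap a b) x ⟨
  lookup (tmul a b x) k     ≡⟨ eq ⟩
  lookup (tmul a b x) m     ≡⟨ lookup-map m (swap a b) x ⟩
  swap a b (lookup x m)     ∎))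
  where open ≡-Reasoning

IsPerm⇒surjective : ∀ {x : Perm n} → IsPerm x → ∀ v → ∃ λ k → lookup x k ≡ v
IsPerm⇒surjective {suc n} {x} x-perm v with Finₚ.any? (λ k → lookup x k Fin.≟ v)
... | yes hit = hit
... | no miss = ⊥-elim (Finₚ.<⇒notInjective (ℕₚ.n<1+n n) skip-v-injective)
  where
  -- Without a preimage of v, x would inject Fin (suc n) into Fin n.
  v≢x : ∀ k → v ≢ lookup x k
  v≢x k v≡xk = miss (k , sym v≡xk)
  skip-v : Fin (suc n) → Fin n
  skip-v k = Fin.punchOut (v≢x k)
  skip-v-injective : ∀ {k m} → skip-v k ≡ skip-v m → k ≡ m
  skip-v-injective {k} {m} = x-perm k m ∘ Finₚ.punchOut-injective (v≢x k) (v≢x m)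

map-≡⇒≗ : ∀ {x : Perm n} {f g : Fin n → Fin n} → IsPerm x → map f x ≡ map g x → f ≗ g
map-≡⇒≗ {x = x} {f} {g} x-perm eq v with IsPerm⇒surjective {x = x} x-perm v
... | k , refl = begin
  f (lookup x k)     ≡⟨ lookup-map k f x ⟨
  lookup (map f x) k ≡⟨ cong (λ z → lookup z k) eq ⟩
  lookup (map g x) k ≡⟨ lookup-map k g x ⟩
  g (lookup x k)     ∎
  where open ≡-Reasoning

∑ : (Fin n → ℕ) → ℕ
∑ {n} f = sum (mapL f (allFin n))

∑-suc : (f : Fin (suc n) → ℕ) → ∑ f ≡ f Fin.zero + ∑ (f ∘ Fin.suc)
∑-suc f = cong (λ xs → f Fin.zero + sum xs)
  (trans (map-tabulate Fin.suc f) (sym (map-tabulate id (f ∘ Fin.suc))))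

∑-mono : {f g : Fin n → ℕ} → (∀ q → f q ≤ g q) → ∑ f ≤ ∑ g
∑-mono {zero} f≤g = z≤n
∑-mono {suc n} {f} {g} f≤g rewrite ∑-suc f | ∑-suc g =
  ℕₚ.+-mono-≤ (f≤g Fin.zero) (∑-mono (f≤g ∘ Fin.suc))

∑-+ : (f g : Fin n → ℕ) → ∑ (λ q → f q + g q) ≡ ∑ f + ∑ g
∑-+ {zero} f g = refl
∑-+ {suc n} f g
  rewrite ∑-suc (λ q → f q + g q) | ∑-suc f | ∑-suc g | ∑-+ (f ∘ Fin.suc) (g ∘ Fin.suc) =
  interchange (f Fin.zero) (g Fin.zero) (∑ (f ∘ Fin.suc)) (∑ (g ∘ Fin.suc))

zeroAt : Fin n → (Fin n → ℕ) → Fin n → ℕ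
zeroAt j f = updateAt f j (const 0)

∑-zeroAt : (j : Fin n) (f : Fin n → ℕ) → ∑ f ≡ f j + ∑ (zeroAt j f)
∑-zeroAt {suc n} Fin.zero f = trans (∑-suc f) (cong (f Fin.zero +_) (sym (∑-suc (zeroAt Fin.zero f))))
∑-zeroAt {suc n} (Fin.suc j) f = begin
  ∑ f                              ≡⟨ ∑-suc f ⟩
  f₀ + ∑ (f ∘ Fin.suc)             ≡⟨ cong (f₀ +_) (∑-zeroAt j (f ∘ Fin.suc)) ⟩
  f₀ + (fⱼ₊₁ + ∑ (zeroAt j (f ∘ Fin.suc))) ≡⟨ x∙yz≈y∙xz f₀ fⱼ₊₁ _ ⟩
  fⱼ₊₁ + (f₀ + ∑ (zeroAt j (f ∘ Fin.suc))) ≡⟨ cong (fⱼ₊₁ +_) (∑-suc (zeroAt (Fin.suc j) f)) ⟨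
  fⱼ₊₁ + ∑ (zeroAt (Fin.suc j) f)  ∎
  where
  open ≡-Reasoning
  f₀ fⱼ₊₁ : ℕ
  f₀ = f Fin.zero
  fⱼ₊₁ = f (Fin.suc j)

zeroAt-≤ : (j : Fin n) {f g : Fin n → ℕ} {q : Fin n} → (q ≢ j → f q ≤ g q) → zeroAt j f q ≤ zeroAt j g q
zeroAt-≤ j {f} {g} {q} f≤g with q Fin.≟ j
... | yes refl rewrite updateAt-updates q {const 0} f = z≤n
... | no q≢j rewrite updateAt-minimal q j {const 0} f q≢j | updateAt-minimal q j {const 0} g q≢j = f≤g q≢j

∑-mono-except₂ : {f g : Fin n → ℕ} (j i : Fin n) → j ≢ i → (∀ q → q ≢ j → q ≢ i → f q ≤ g q) →
  f j + f i ≤ g j + g i → ∑ f ≤ ∑ g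
∑-mono-except₂ {f = f} {g} j i j≢i f≤g f≤g-at-j,i = begin
  ∑ f                   ≡⟨ ∑-split f ⟩
  f j + f i + ∑-rest f  ≤⟨ ℕₚ.+-mono-≤ f≤g-at-j,i ∑-rest-≤ ⟩
  g j + g i + ∑-rest g  ≡⟨ ∑-split g ⟨
  ∑ g                   ∎
  where
  open ℕₚ.≤-Reasoning
  ∑-rest : (Fin _ → ℕ) → ℕ
  ∑-rest h = ∑ (zeroAt i (zeroAt j h))
  ∑-rest-≤ : ∑-rest f ≤ ∑-rest g
  ∑-rest-≤ = ∑-mono λ q → zeroAt-≤ i λ q≢i → zeroAt-≤ j λ q≢j → f≤g q q≢j q≢i
  ∑-split : (h : Fin _ → ℕ) → ∑ h ≡ h j + h i + ∑-rest h
  ∑-split h = begin-equality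
    ∑ h                               ≡⟨ ∑-zeroAt j h ⟩
    h j + ∑ (zeroAt j h)              ≡⟨ cong (h j +_) (∑-zeroAt i (zeroAt j h)) ⟩
    h j + (zeroAt j h i + ∑-rest h)   ≡⟨ cong (λ z → h j + (z + ∑-rest h)) (updateAt-minimal i j h (j≢i ∘ sym)) ⟩
    h j + (h i + ∑-rest h)            ≡⟨ ℕₚ.+-assoc (h j) (h i) _ ⟨
    h j + h i + ∑-rest h              ∎

-- Inversions and the length

𝟙 : Bool → ℕ
𝟙 b = if b then 1 else 0

𝟙-rearrangement : ∀ x y z w → (T y → T x) → (T z → T w) → 𝟙 (x ∧ z) + 𝟙 (y ∧ w) ≤ 𝟙 (x ∧ w) + 𝟙 (y ∧ z)
𝟙-rearrangement false false z w _ _ = z≤n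
𝟙-rearrangement false true z w y⇒x _ = ⊥-elim (y⇒x tt)
𝟙-rearrangement true true z w _ _ = ℕₚ.≤-reflexive (ℕₚ.+-comm (𝟙 z) (𝟙 w))
𝟙-rearrangement true false false w _ _ = z≤n
𝟙-rearrangement true false true true _ _ = ℕₚ.≤-refl
𝟙-rearrangement true false true false _ z⇒w = ⊥-elim (z⇒w tt)

inversion : (p q vp vq : ℕ) → ℕ
inversion p q vp vq = 𝟙 ((p <ᵇ q) ∧ (vq <ᵇ vp))

inversions : Perm n → Fin n → Fin n → ℕ
inversions x a b = inversion (toℕ a) (toℕ b) (toℕ (lookup x a)) (toℕ (lookup x b))

ℓ≡∑∑inversions : (x : Perm n) → ℓ x ≡ ∑ λ a → ∑ (inversions x a)
ℓ≡∑∑inversions x = refl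

inversions-≡ : ∀ (x : Perm n) {a b va vb} → lookup x a ≡ va → lookup x b ≡ vb →
  inversions x a b ≡ inversion (toℕ a) (toℕ b) (toℕ va) (toℕ vb)
inversions-≡ x refl refl = refl

inversion-≮ : ∀ p q vp vq → ¬ p < q → inversion p q vp vq ≡ 0
inversion-≮ p q vp vq p≮q with p <ᵇ q in p<ᵇq
... | false = refl
... | true = ⊥-elim (p≮q (ℕₚ.<ᵇ⇒< p q (subst T (sym p<ᵇq) tt)))

inversion-≯ : ∀ p q vp vq → ¬ vq < vp → inversion p q vp vq ≡ 0
inversion-≯ p q vp vq vq≮vp with vq <ᵇ vp in vq<ᵇvp
... | false = cong 𝟙 (∧-zeroʳ (p <ᵇ q))
... | true = ⊥-elim (vq≮vp (ℕₚ.<ᵇ⇒< vq vp (subst T (sym vq<ᵇvp) tt)))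

inversions-≮ : ∀ (x : Perm n) {a b} → ¬ toℕ a < toℕ b → inversions x a b ≡ 0
inversions-≮ x {a} {b} = inversion-≮ (toℕ a) (toℕ b) (toℕ (lookup x a)) (toℕ (lookup x b))

<ᵇ-trans : ∀ {m n o} → m < n → T (n <ᵇ o) → T (m <ᵇ o)
<ᵇ-trans {n = n} {o} m<n n<ᵇo = ℕₚ.<⇒<ᵇ (ℕₚ.<-trans m<n (ℕₚ.<ᵇ⇒< n o n<ᵇo))

<ᵇ-transʳ : ∀ {m n o} → T (m <ᵇ n) → n < o → T (m <ᵇ o)
<ᵇ-transʳ {m} {n} m<ᵇn n<o = ℕₚ.<⇒<ᵇ (ℕₚ.<-trans (ℕₚ.<ᵇ⇒< m n m<ᵇn) n<o)

inversion-rows : ∀ {j i α γ} → j < i → α < γ → ∀ b v →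
  inversion j b α v + inversion i b γ v ≤ inversion j b γ v + inversion i b α v
inversion-rows {j} {i} {α} {γ} j<i α<γ b v =
  𝟙-rearrangement (j <ᵇ b) (i <ᵇ b) (v <ᵇ α) (v <ᵇ γ) (<ᵇ-trans {o = b} j<i) (λ v<ᵇα → <ᵇ-transʳ v<ᵇα α<γ)

inversion-columns : ∀ {j i α γ} → j < i → α < γ → ∀ p w →
  inversion p j w α + inversion p i w γ ≤ inversion p j w γ + inversion p i w α
inversion-columns {j} {i} {α} {γ} j<i α<γ p w = begin
  inversion p j w α + inversion p i w γ ≡⟨ ℕₚ.+-comm (inversion p j w α) _ ⟩
  inversion p i w γ + inversion p j w α ≤⟨ 𝟙-rearrangement (p <ᵇ i) (p <ᵇ j) (γ <ᵇ w) (α <ᵇ w)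
                                             (λ p<ᵇj → <ᵇ-transʳ p<ᵇj j<i) (<ᵇ-trans {o = w} α<γ) ⟩
  inversion p i w α + inversion p j w γ ≡⟨ ℕₚ.+-comm (inversion p i w α) _ ⟩
  inversion p j w γ + inversion p i w α ∎
  where open ℕₚ.≤-Reasoning

-- Only the rows and columns j, i of the inversion table change, and there the exchange of the
-- values α < γ is an instance of 𝟙-rearrangement.
module NonInversionExchange {x : Perm n} {j i α γ : Fin n} (x-perm : IsPerm x)
  (xj≡α : lookup x j ≡ α) (xi≡γ : lookup x i ≡ γ) (j<i : toℕ j < toℕ i) (α<γ : toℕ α < toℕ γ) where

  private
    g : Perm n
    g = tmul α γ x

    j≢i : j ≢ i
    j≢i refl = ℕₚ.<-irrefl refl j<i

    gj≡γ : lookup g j ≡ γ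
    gj≡γ = trans (tmul-at α γ x xj≡α) (swap-fst α γ)

    gi≡α : lookup g i ≡ α
    gi≡α = trans (tmul-at α γ x xi≡γ) (swap-snd α γ)

    g-other : ∀ {k} → k ≢ j → k ≢ i → lookup g k ≡ lookup x k
    g-other {k} k≢j k≢i = trans (tmul-at α γ x refl)
      (swap-other (λ xk≡α → k≢j (x-perm k j (trans xk≡α (sym xj≡α))))
                  (λ xk≡γ → k≢i (x-perm k i (trans xk≡γ (sym xi≡γ)))))

    other-row : ∀ p → p ≢ j → p ≢ i → ∑ (inversions x p) ≤ ∑ (inversions g p)
    other-row p p≢j p≢i = ∑-mono-except₂ j i j≢i same-entry at-columns-j,i
      where
      gp : lookup g p ≡ lookup x p
      gp = g-other p≢j p≢i
      same-entry : ∀ b → b ≢ j → b ≢ i → inversions x p b ≤ inversions g p b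
      same-entry b b≢j b≢i = ℕₚ.≤-reflexive (sym (inversions-≡ g gp (g-other b≢j b≢i)))
      at-columns-j,i : inversions x p j + inversions x p i ≤ inversions g p j + inversions g p i
      at-columns-j,i = subst₂ _≤_
        (sym (cong₂ _+_ (inversions-≡ x refl xj≡α) (inversions-≡ x refl xi≡γ)))
        (sym (cong₂ _+_ (inversions-≡ g gp gj≡γ) (inversions-≡ g gp gi≡α)))
        (inversion-columns j<i α<γ (toℕ p) (toℕ (lookup x p)))

    column-of-rows-j,i : ∀ b → inversions x j b + inversions x i b ≤ inversions g j b + inversions g i b
    column-of-rows-j,i b with b Fin.≟ j | b Fin.≟ i
    ... | yes refl | _ = ℕₚ.≤-trans (ℕₚ.≤-reflexive
      (cong₂ _+_ (inversions-≮ x (ℕₚ.<-irrefl refl)) (inversions-≮ x (ℕₚ.<-asym j<i)))) z≤n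
    ... | no _ | yes refl = ℕₚ.≤-trans (ℕₚ.≤-reflexive
      (cong₂ _+_ (trans (inversions-≡ x xj≡α xi≡γ) (inversion-≯ (toℕ j) (toℕ i) (toℕ α) (toℕ γ) (ℕₚ.<-asym α<γ)))
                 (inversions-≮ x (ℕₚ.<-irrefl refl)))) z≤n
    ... | no b≢j | no b≢i = subst₂ _≤_
      (sym (cong₂ _+_ (inversions-≡ x {b = b} xj≡α refl) (inversions-≡ x {b = b} xi≡γ refl)))
      (sym (cong₂ _+_ (inversions-≡ g gj≡γ gb) (inversions-≡ g gi≡α gb)))
      (inversion-rows j<i α<γ (toℕ b) (toℕ (lookup x b)))
      where
      gb : lookup g b ≡ lookup x b
      gb = g-other b≢j b≢i

    rows-j,i : ∑ (inversions x j) + ∑ (inversions x i) ≤ ∑ (inversions g j) + ∑ (inversions g i)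
    rows-j,i = subst₂ _≤_ (∑-+ (inversions x j) (inversions x i)) (∑-+ (inversions g j) (inversions g i))
      (∑-mono column-of-rows-j,i)

  ℓ-≤-exchange : ℓ x ≤ ℓ (tmul α γ x)
  ℓ-≤-exchange = begin
    ℓ x                          ≡⟨ ℓ≡∑∑inversions x ⟩
    ∑ (λ p → ∑ (inversions x p)) ≤⟨ ∑-mono-except₂ j i j≢i other-row rows-j,i ⟩
    ∑ (λ p → ∑ (inversions g p)) ≡⟨ ℓ≡∑∑inversions g ⟨
    ℓ g                          ∎
    where open ℕₚ.≤-Reasoning

ascent⇒ordered : ∀ {x : Perm n} {a c i j} → IsPerm x → ℓ x < ℓ (tmul a c x) →
  lookup x i ≡ a → lookup x j ≡ c → toℕ a < toℕ c → toℕ i < toℕ j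
ascent⇒ordered {n} {x} {a} {c} {i} {j} x-perm ascent xi≡a xj≡c a<c with ℕₚ.<-cmp (toℕ i) (toℕ j)
... | tri< i<j _ _ = i<j
... | tri≈ _ i≡j _ = ⊥-elim (ℕₚ.<-irrefl (cong toℕ a≡c) a<c)
  where
  a≡c : a ≡ c
  a≡c = trans (sym xi≡a) (trans (cong (lookup x) (Finₚ.toℕ-injective i≡j)) xj≡c)
... | tri> _ _ j<i = ⊥-elim (ℕₚ.<-irrefl refl (ℕₚ.<-≤-trans ascent ℓf≤ℓx))
  where
  f : Perm n
  f = tmul a c x
  -- In f the values a < c stand at positions j < i, and exchanging them gives back x.
  ℓf≤ℓx : ℓ f ≤ ℓ x
  ℓf≤ℓx = subst (ℓ f ≤_) (cong ℓ (tmul-involutive a c x))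
    (NonInversionExchange.ℓ-≤-exchange {x = f} (tmul-IsPerm a c x x-perm)
      (trans (tmul-at a c x xj≡c) (swap-snd a c)) (trans (tmul-at a c x xi≡a) (swap-fst a c)) j<i a<c)

SameOrder : (a c i j : Fin n) → Set
SameOrder a c i j = (toℕ a < toℕ c → toℕ i < toℕ j) × (toℕ c < toℕ a → toℕ j < toℕ i)

ascent⇒same-order : ∀ {x : Perm n} {a c i j} → IsPerm x → ℓ x < ℓ (tmul a c x) →
  lookup x i ≡ a → lookup x j ≡ c → SameOrder a c i j
ascent⇒same-order {x = x} {a} {c} x-perm ascent xi≡a xj≡c =
  ascent⇒ordered {x = x} x-perm ascent xi≡a xj≡c ,
  ascent⇒ordered {x = x} x-perm (subst (λ z → ℓ x < ℓ z) (tmul-cong (swap-comm a c) x) ascent) xj≡c xi≡a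

-- Products of two transpositions

record ThreeCycle (W : Fin n → Fin n) (p q r : Fin n) : Set where
  field
    p↦q : W p ≡ q
    q↦r : W q ≡ r
    r↦p : W r ≡ p
    p≢q : p ≢ q
    q≢r : q ≢ r
    r≢p : r ≢ p
    fixes : ∀ v → v ≢ p → v ≢ q → v ≢ r → W v ≡ v

module _ {W : Fin n → Fin n} {p q r : Fin n} (cyc : ThreeCycle W p q r) where
  open ThreeCycle cyc

  three-cycle-rotate : ThreeCycle W q r p
  three-cycle-rotate = record
    { p↦q = q↦r ; q↦r = r↦p ; r↦p = p↦q ; p≢q = q≢r ; q≢r = r≢p ; r≢p = p≢q
    ; fixes = λ v v≢q v≢r v≢p → fixes v v≢p v≢q v≢r
    }

  three-cycle-support : ∀ {v} → W v ≢ v → v ≡ p ⊎ v ≡ q ⊎ v ≡ r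
  three-cycle-support {v} moved with v Fin.≟ p | v Fin.≟ q | v Fin.≟ r
  ... | yes v≡p | _ | _ = inj₁ v≡p
  ... | no _ | yes v≡q | _ = inj₂ (inj₁ v≡q)
  ... | no _ | no _ | yes v≡r = inj₂ (inj₂ v≡r)
  ... | no v≢p | no v≢q | no v≢r = ⊥-elim (moved (fixes v v≢p v≢q v≢r))

  three-cycle-factor : W ≗ swap p r ∘ swap p q
  three-cycle-factor v = by-cases (v Fin.≟ p) (v Fin.≟ q) (v Fin.≟ r)
    where
    by-cases : Dec (v ≡ p) → Dec (v ≡ q) → Dec (v ≡ r) → W v ≡ swap p r (swap p q v)
    by-cases (yes refl) _ _ =
      trans p↦q (sym (trans (cong (swap v r) (swap-fst v q)) (swap-other (p≢q ∘ sym) q≢r)))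
    by-cases (no _) (yes refl) _ =
      trans q↦r (sym (trans (cong (swap p r) (swap-snd p v)) (swap-fst p r)))
    by-cases (no _) (no _) (yes refl) =
      trans r↦p (sym (trans (cong (swap p v) (swap-other r≢p (q≢r ∘ sym))) (swap-snd p v)))
    by-cases (no v≢p) (no v≢q) (no v≢r) = trans (fixes v v≢p v≢q v≢r)
      (sym (trans (cong (swap p r) (swap-other v≢p v≢q)) (swap-other v≢p v≢r)))

data FactorShape (W : Fin n → Fin n) (a c d e : Fin n) : Set where
  disjoint : W a ≡ c → (∀ z → W z ≢ z → swap z (W z) ≗ swap a c ⊎ swap z (W z) ≗ swap d e) →
    FactorShape W a c d e
  cycle : ∀ {p q r} → ThreeCycle W p q r → swap a c ≗ swap p q → FactorShape W a c d e

module TranspositionProduct {W : Fin n → Fin n} {a c d e : Fin n} (a≢c : a ≢ c) (W≗st : W ≗ swap d e ∘ swap a c) where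

  Wa≡sc : W a ≡ swap d e c
  Wa≡sc = trans (W≗st a) (cong (swap d e) (swap-fst a c))

  Wc≡sa : W c ≡ swap d e a
  Wc≡sa = trans (W≗st c) (cong (swap d e) (swap-snd a c))

  W-other : ∀ {v} → v ≢ a → v ≢ c → W v ≡ swap d e v
  W-other v≢a v≢c = trans (W≗st _) (cong (swap d e) (swap-other v≢a v≢c))

  three-cycle-of-factor : swap d e a ≡ a → swap d e c ≢ c → ThreeCycle W c a (swap d e c)
  three-cycle-of-factor sa≡a sc≢c = record
    { p↦q = trans Wc≡sa sa≡a
    ; q↦r = Wa≡sc
    ; r↦p = trans (W-other m≢a sc≢c) (swap-involutive d e c)
    ; p≢q = a≢c ∘ sym
    ; q≢r = m≢a ∘ sym
    ; r≢p = sc≢c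
    ; fixes = λ v v≢c v≢a v≢m → trans (W-other v≢a v≢c)
                (trans (swap-determined d e (sc≢c ∘ sym) v) (swap-other v≢c v≢m))
    }
    where
    m≢a : swap d e c ≢ a
    m≢a m≡a = a≢c (sym (swap-injective d e (trans m≡a (sym sa≡a))))

factor-shape : ∀ {W : Fin n → Fin n} {a c d e} → a ≢ c → W ≗ swap d e ∘ swap a c → ¬ (W ≗ id) →
  FactorShape W a c d e
factor-shape {W = W} {a} {c} {d} {e} a≢c W≗st W≢id with swap d e a Fin.≟ a | swap d e c Fin.≟ c
... | yes sa≡a | yes sc≡c = disjoint Wa≡c orbit-pairs
  where
  open TranspositionProduct a≢c W≗st
  Wa≡c : W a ≡ c
  Wa≡c = trans Wa≡sc sc≡c
  orbit-pairs : ∀ z → W z ≢ z → swap z (W z) ≗ swap a c ⊎ swap z (W z) ≗ swap d e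
  orbit-pairs z Wz≢z with z Fin.≟ a | z Fin.≟ c
  ... | yes refl | _ = inj₁ λ v → cong (λ y → swap z y v) Wa≡c
  ... | no _ | yes refl = inj₁ λ v → trans (cong (λ y → swap z y v) (trans Wc≡sa sa≡a)) (swap-comm z a v)
  ... | no z≢a | no z≢c = inj₂ λ v → trans (cong (λ y → swap z y v) Wz≡sz)
                                           (sym (swap-determined d e (λ z≡sz → Wz≢z (trans Wz≡sz (sym z≡sz))) v))
    where
    Wz≡sz : W z ≡ swap d e z
    Wz≡sz = W-other z≢a z≢c
... | yes sa≡a | no sc≢c = cycle (three-cycle-of-factor sa≡a sc≢c) (swap-comm a c)
  where open TranspositionProduct a≢c W≗st
... | no sa≢a | yes sc≡c = cycle (TranspositionProduct.three-cycle-of-factor (a≢c ∘ sym) W≗ts sc≡c sa≢a) λ _ → refl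
  where
  W≗ts : W ≗ swap d e ∘ swap c a
  W≗ts v = trans (W≗st v) (cong (swap d e) (swap-comm a c v))
... | no sa≢a | no sc≢c = ⊥-elim (W≢id λ v → trans (W≗st v) (trans (s≗t (swap a c v)) (swap-involutive a c v)))
  where
  -- (d e) moves a and c, hence equals (a c).
  s≗t : swap d e ≗ swap a c
  s≗t with swap-moved a (swap d e a) (λ moves-c → sc≢c (trans (swap-determined d e (sa≢a ∘ sym) c) moves-c))
  ... | inj₁ c≡a = ⊥-elim (a≢c (sym c≡a))
  ... | inj₂ c≡sa = λ v → trans (swap-determined d e (sa≢a ∘ sym) v) (cong (λ y → swap a y v) (sym c≡sa))

-- Paths of length two in the Bruhat graph

Extreme : ℕ → ℕ → ℕ → Set
Extreme a b c = (a < b × c < b) ⊎ (b < a × b < c)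

same-order⇒extreme : ∀ {a b c i j : Fin n} → a ≢ b → c ≢ b → SameOrder a b i j → SameOrder c b i j →
  Extreme (toℕ a) (toℕ b) (toℕ c)
same-order⇒extreme {a = a} {b} {c} a≢b c≢b (a<b⇒ , b<a⇒) (c<b⇒ , b<c⇒)
  with ℕₚ.<-cmp (toℕ a) (toℕ b) | ℕₚ.<-cmp (toℕ c) (toℕ b)
... | tri≈ _ a≡b _ | _ = ⊥-elim (a≢b (Finₚ.toℕ-injective a≡b))
... | _ | tri≈ _ c≡b _ = ⊥-elim (c≢b (Finₚ.toℕ-injective c≡b))
... | tri< a<b _ _ | tri< c<b _ _ = inj₁ (a<b , c<b)
... | tri< a<b _ _ | tri> _ _ b<c = ⊥-elim (ℕₚ.<-asym (a<b⇒ a<b) (b<c⇒ b<c))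
... | tri> _ _ b<a | tri< c<b _ _ = ⊥-elim (ℕₚ.<-asym (b<a⇒ b<a) (c<b⇒ c<b))
... | tri> _ _ b<a | tri> _ _ b<c = inj₂ (b<a , b<c)

¬all-extreme : ∀ {p q r} → Extreme p q r → Extreme p r q → Extreme q p r → ⊥
¬all-extreme (inj₁ (_ , r<q)) (inj₁ (_ , q<r)) _ = ℕₚ.<-asym r<q q<r
¬all-extreme (inj₁ (p<q , _)) (inj₂ _) (inj₁ (q<p , _)) = ℕₚ.<-asym p<q q<p
¬all-extreme (inj₁ _) (inj₂ (r<p , _)) (inj₂ (_ , p<r)) = ℕₚ.<-asym r<p p<r
¬all-extreme (inj₂ (_ , q<r)) (inj₂ (_ , r<q)) _ = ℕₚ.<-asym q<r r<q
¬all-extreme (inj₂ _) (inj₁ (p<r , _)) (inj₁ (_ , r<p)) = ℕₚ.<-asym p<r r<p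
¬all-extreme (inj₂ (q<p , _)) (inj₁ _) (inj₂ (p<q , _)) = ℕₚ.<-asym q<p p<q

Middle : Perm n → Perm n → Perm n → Set
Middle x y b = Edge x b × Edge b y

Edge⇒ℓ< : ∀ {x y : Perm n} → Edge x y → ℓ x < ℓ y
Edge⇒ℓ< (_ , _ , _ , _ , ℓx<ℓy) = ℓx<ℓy

middle-value-map : ∀ {x y b : Perm n} → Middle x y b → ∃ λ W → y ≡ map W x
middle-value-map {x = x} ((a , c , _ , refl , _) , (d , e , _ , refl , _)) =
  swap d e ∘ swap a c , sym (map-∘ (swap d e) (swap a c) x)

middle-value-map-nontrivial : ∀ {x y b : Perm n} {W} → y ≡ map W x → Middle x y b → ¬ (W ≗ id)
middle-value-map-nontrivial {x = x} {y} {W = W} y≡Wx (x→b , b→y) W≗id =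
  ℕₚ.<-irrefl (cong ℓ (sym y≡x)) (ℕₚ.<-trans (Edge⇒ℓ< x→b) (Edge⇒ℓ< b→y))
  where
  y≡x : y ≡ x
  y≡x = trans y≡Wx (trans (map-cong W≗id x) (map-id x))

middle-factor : ∀ {x y b : Perm n} {W} → IsPerm x → y ≡ map W x → Middle x y b →
  ∃₂ λ a c → a ≢ c × b ≡ tmul a c x × ∃₂ λ d e → W ≗ swap d e ∘ swap a c
middle-factor {x = x} x-perm y≡Wx ((a , c , a≢c , refl , _) , (d , e , _ , refl , _)) =
  a , c , a≢c , refl , d , e , map-≡⇒≗ x-perm (trans (sym y≡Wx) (sym (map-∘ (swap d e) (swap a c) x)))

middle-orbit : ∀ {x y b : Perm n} {W} → IsPerm x → y ≡ map W x → Middle x y b →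
  ∃ λ z → W z ≢ z × b ≡ tmul z (W z) x
middle-orbit {x = x} x-perm y≡Wx m
  with a , c , a≢c , refl , d , e , W≗st ← middle-factor x-perm y≡Wx m
  with factor-shape a≢c W≗st (middle-value-map-nontrivial y≡Wx m)
... | disjoint Wa≡c _ = a , (λ Wa≡a → a≢c (trans (sym Wa≡a) Wa≡c)) , cong (λ w → tmul a w x) (sym Wa≡c)
... | cycle {p} cyc t≗pq = p , (λ Wp≡p → p≢q (trans (sym Wp≡p) p↦q)) ,
  trans (tmul-cong t≗pq x) (cong (λ w → tmul p w x) (sym p↦q))
  where open ThreeCycle cyc

module _ {x : Perm n} (x-perm : IsPerm x) where

  position : Fin n → Fin n
  position v = proj₁ (IsPerm⇒surjective {x = x} x-perm v)

  lookup-position : ∀ v → lookup x (position v) ≡ v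
  lookup-position v = proj₂ (IsPerm⇒surjective {x = x} x-perm v)

  two-ascents⇒same-orders : ∀ {p q r} → r ≢ p → r ≢ q →
    ℓ x < ℓ (tmul p q x) → ℓ (tmul p q x) < ℓ (tmul p r (tmul p q x)) →
    SameOrder p q (position p) (position q) × SameOrder p r (position q) (position r)
  two-ascents⇒same-orders {p} {q} {r} r≢p r≢q ascent₁ ascent₂ =
    ascent⇒same-order {x = x} x-perm ascent₁ (lookup-position p) (lookup-position q) ,
    ascent⇒same-order {x = b} (tmul-IsPerm p q x x-perm) ascent₂ b-at-q b-at-r
    where
    b : Perm n
    b = tmul p q x
    b-at-q : lookup b (position q) ≡ p
    b-at-q = trans (tmul-at p q x (lookup-position q)) (swap-snd p q)
    b-at-r : lookup b (position r) ≡ r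
    b-at-r = trans (tmul-at p q x (lookup-position r)) (swap-other r≢p r≢q)

  module _ {y : Perm n} {W : Fin n → Fin n} (y≡Wx : y ≡ map W x) where

    three-cycle-middle-orders : ∀ {p q r} → ThreeCycle W p q r → Middle x y (tmul p q x) →
      SameOrder p q (position p) (position q) × SameOrder p r (position q) (position r)
    three-cycle-middle-orders {p} {q} {r} cyc (x→b , b→y) =
      two-ascents⇒same-orders r≢p (q≢r ∘ sym) (Edge⇒ℓ< x→b) (subst (λ z → ℓ (tmul p q x) < ℓ z) y≡srb (Edge⇒ℓ< b→y))
      where
      open ThreeCycle cyc
      y≡srb : y ≡ tmul p r (tmul p q x)
      y≡srb = trans y≡Wx (trans (map-cong (three-cycle-factor cyc) x) (map-∘ (swap p r) (swap p q) x))

    -- The three orders force each of p, q, r to be extreme among them.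
    three-cycle-middles : ∀ {p q r} → ThreeCycle W p q r →
      Middle x y (tmul p q x) → Middle x y (tmul q r x) → Middle x y (tmul r p x) → ⊥
    three-cycle-middles cyc via-pq via-qr via-rp
      with pq , pr ← three-cycle-middle-orders cyc via-pq
      with qr , qp ← three-cycle-middle-orders (three-cycle-rotate cyc) via-qr
      with rp , rq ← three-cycle-middle-orders (three-cycle-rotate (three-cycle-rotate cyc)) via-rp =
      ¬all-extreme (same-order⇒extreme p≢q (q≢r ∘ sym) pq rq)
                   (same-order⇒extreme (r≢p ∘ sym) q≢r pr qr)
                   (same-order⇒extreme (p≢q ∘ sym) r≢p qp rp)
      where open ThreeCycle cyc

¬three-distinct-among-two : ∀ {A : Set} {b₁ b₂ b₃ o₁ o₂ : A} →
  b₁ ≡ o₁ ⊎ b₁ ≡ o₂ → b₂ ≡ o₁ ⊎ b₂ ≡ o₂ → b₃ ≡ o₁ ⊎ b₃ ≡ o₂ → b₁ ≢ b₂ → b₁ ≢ b₃ → b₂ ≢ b₃ → ⊥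
¬three-distinct-among-two (inj₁ refl) (inj₁ refl) _ b₁≢b₂ _ _ = b₁≢b₂ refl
¬three-distinct-among-two (inj₂ refl) (inj₂ refl) _ b₁≢b₂ _ _ = b₁≢b₂ refl
¬three-distinct-among-two (inj₁ refl) (inj₂ refl) (inj₁ refl) _ b₁≢b₃ _ = b₁≢b₃ refl
¬three-distinct-among-two (inj₁ refl) (inj₂ refl) (inj₂ refl) _ _ b₂≢b₃ = b₂≢b₃ refl
¬three-distinct-among-two (inj₂ refl) (inj₁ refl) (inj₁ refl) _ _ b₂≢b₃ = b₂≢b₃ refl
¬three-distinct-among-two (inj₂ refl) (inj₁ refl) (inj₂ refl) _ b₁≢b₃ _ = b₁≢b₃ refl

three-distinct-among-three : ∀ {A : Set} (P : A → Set) {b₁ b₂ b₃ o₁ o₂ o₃ : A} → b₁ ≡ o₁ →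
  b₂ ≡ o₁ ⊎ b₂ ≡ o₂ ⊎ b₂ ≡ o₃ → b₃ ≡ o₁ ⊎ b₃ ≡ o₂ ⊎ b₃ ≡ o₃ → b₁ ≢ b₂ → b₁ ≢ b₃ → b₂ ≢ b₃ →
  P b₂ → P b₃ → P o₂ × P o₃
three-distinct-among-three P refl (inj₁ refl) _ b₁≢b₂ _ _ _ _ = ⊥-elim (b₁≢b₂ refl)
three-distinct-among-three P refl _ (inj₁ refl) _ b₁≢b₃ _ _ _ = ⊥-elim (b₁≢b₃ refl)
three-distinct-among-three P refl (inj₂ (inj₁ refl)) (inj₂ (inj₁ refl)) _ _ b₂≢b₃ _ _ = ⊥-elim (b₂≢b₃ refl)
three-distinct-among-three P refl (inj₂ (inj₁ refl)) (inj₂ (inj₂ refl)) _ _ _ P₂ P₃ = P₂ , P₃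
three-distinct-among-three P refl (inj₂ (inj₂ refl)) (inj₂ (inj₁ refl)) _ _ _ P₂ P₃ = P₃ , P₂
three-distinct-among-three P refl (inj₂ (inj₂ refl)) (inj₂ (inj₂ refl)) _ _ b₂≢b₃ _ _ = ⊥-elim (b₂≢b₃ refl)

no-three-middles : ∀ {x y b₁ b₂ b₃ : Perm n} → IsPerm x → Middle x y b₁ → Middle x y b₂ → Middle x y b₃ →
  b₁ ≢ b₂ → b₁ ≢ b₃ → b₂ ≢ b₃ → ⊥
no-three-middles {x = x} {y} {b₁} x-perm m₁ m₂ m₃ b₁≢b₂ b₁≢b₃ b₂≢b₃
  with W , y≡Wx ← middle-value-map m₁
  with a , c , a≢c , b₁≡tx , d , e , W≗st ← middle-factor x-perm y≡Wx m₁
  with factor-shape a≢c W≗st (middle-value-map-nontrivial y≡Wx m₁)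
... | disjoint _ orbit-pairs =
  ¬three-distinct-among-two (in-pair m₁) (in-pair m₂) (in-pair m₃) b₁≢b₂ b₁≢b₃ b₂≢b₃
  where
  in-pair : ∀ {b} → Middle x y b → b ≡ tmul a c x ⊎ b ≡ tmul d e x
  in-pair m with z , Wz≢z , b≡ ← middle-orbit x-perm y≡Wx m =
    Sum.map (trans b≡ ∘ flip tmul-cong x) (trans b≡ ∘ flip tmul-cong x) (orbit-pairs z Wz≢z)
... | cycle {p} {q} {r} cyc t≗pq =
  three-cycle-middles x-perm y≡Wx cyc (subst (Middle x y) b₁≡pqx m₁) (proj₁ via-qr,rp) (proj₂ via-qr,rp)
  where
  open ThreeCycle cyc
  b₁≡pqx : b₁ ≡ tmul p q x
  b₁≡pqx = trans b₁≡tx (tmul-cong t≗pq x)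
  in-cycle : ∀ {b} → Middle x y b → b ≡ tmul p q x ⊎ b ≡ tmul q r x ⊎ b ≡ tmul r p x
  in-cycle m with z , Wz≢z , b≡ ← middle-orbit x-perm y≡Wx m with three-cycle-support cyc Wz≢z
  ... | inj₁ refl = inj₁ (trans b≡ (cong (λ w → tmul z w x) p↦q))
  ... | inj₂ (inj₁ refl) = inj₂ (inj₁ (trans b≡ (cong (λ w → tmul z w x) q↦r)))
  ... | inj₂ (inj₂ refl) = inj₂ (inj₂ (trans b≡ (cong (λ w → tmul z w x) r↦p)))
  via-qr,rp : Middle x y (tmul q r x) × Middle x y (tmul r p x)
  via-qr,rp = three-distinct-among-three (Middle x y) b₁≡pqx (in-cycle m₂) (in-cycle m₃)
    b₁≢b₂ b₁≢b₃ b₂≢b₃ m₂ m₃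

-- Finite enumeration and reachability

vectors : ∀ {A : Set} → List A → (k : ℕ) → List (Vec A k)
vectors xs zero = [ [] ]
vectors xs (suc k) = cartesianProductWith _∷_ xs (vectors xs k)

∈-vectors : ∀ {A : Set} {xs : List A} → (∀ a → a ∈ xs) → ∀ {k} (v : Vec A k) → v ∈ vectors xs k
∈-vectors complete [] = here refl
∈-vectors complete (a ∷ v) = ∈-cartesianProductWith⁺ _∷_ (complete a) (∈-vectors complete v)

module FiniteReachability {A : Set} (_≟_ : DecidableEquality A) {U : List A} (U-complete : ∀ a → a ∈ U)
  {R : A → A → Set} (R? : ∀ a b → Dec (R a b)) (x₀ : A) where

  Reachable : List A → Set
  Reachable V = ∀ {a} → a ∈ V → Star R x₀ a

  Closed : List A → Set
  Closed V = ∀ {a b} → a ∈ V → R a b → b ∈ V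

  ∈-closed : ∀ {V a b} → Closed V → a ∈ V → Star R a b → b ∈ V
  ∈-closed closed a∈V ε = a∈V
  ∈-closed closed a∈V (Rab ◅ rest) = ∈-closed closed (closed a∈V Rab) rest

  -- Every element of U is visited (in V) or pending (in rest); each step visits one pending
  -- R-successor of V, so rest shrinks.
  saturate : ∀ k (V rest : List A) → length rest < k → (∀ a → a ∈ V ⊎ a ∈ rest) →
    x₀ ∈ V → Reachable V → ∃ λ V′ → x₀ ∈ V′ × Reachable V′ × Closed V′
  saturate (suc k) V rest |rest|≤k covered x₀∈V reachable
    with any? (λ b → any? (λ a → R? a b) V) rest
  ... | no none = V , x₀∈V , reachable , closed
    where
    closed : Closed V
    closed {b = b} a∈V Rab with covered b
    ... | inj₁ b∈V = b∈V
    ... | inj₂ b∈rest = ⊥-elim (none (lose b∈rest (lose a∈V Rab)))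
  ... | yes found with b , b∈rest , from-V ← find found =
    saturate k (b ∷ V) rest′ shorter covered′ (there x₀∈V) reachable′
    where
    rest′ : List A
    rest′ = filter (λ a → ¬? (a ≟ b)) rest
    shorter : length rest′ < k
    shorter = ℕₚ.<-≤-trans (filter-notAll (λ a → ¬? (a ≟ b)) rest (Any.map (λ b≡a a≢b → a≢b (sym b≡a)) b∈rest))
                           (ℕₚ.≤-pred |rest|≤k)
    covered′ : ∀ a → a ∈ b ∷ V ⊎ a ∈ rest′
    covered′ a with a ≟ b | covered a
    ... | yes refl | _ = inj₁ (here refl)
    ... | no _ | inj₁ a∈V = inj₁ (there a∈V)
    ... | no a≢b | inj₂ a∈rest = inj₂ (∈-filter⁺ (λ a → ¬? (a ≟ b)) a∈rest a≢b)
    reachable′ : Reachable (b ∷ V)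
    reachable′ (here refl) with a , a∈V , Rab ← find from-V = reachable a∈V ◅◅ (Rab ◅ ε)
    reachable′ (there a∈V) = reachable a∈V

  closure : ∃ λ V → x₀ ∈ V × Reachable V × Closed V
  closure = saturate (suc (length U)) [ x₀ ] U ℕₚ.≤-refl (inj₂ ∘ U-complete) (here refl) λ { (here refl) → ε }

  reachable? : ∀ {P : A → Set} → (∀ a → Dec (P a)) → Dec (∃ λ q → Star R x₀ q × P q)
  reachable? P? with V , x₀∈V , reachable , closed ← closure with any? P? V
  ... | yes hit with q , q∈V , Pq ← find hit = yes (q , reachable q∈V , Pq)
  ... | no miss = no λ (q , x₀⇝q , Pq) → miss (lose (∈-closed closed x₀∈V x₀⇝q) Pq)

-- The time-support graph

_≟ₚ_ : DecidableEquality (Perm n)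
_≟ₚ_ = ≡-dec Fin._≟_

∈-perms : (x : Perm n) → x ∈ vectors (allFin n) n
∈-perms = ∈-vectors ∈-allFin

Edge? : (x y : Perm n) → Dec (Edge x y)
Edge? x y = Finₚ.any? λ a → Finₚ.any? λ b →
  ¬? (a Fin.≟ b) ×-dec (y ≟ₚ tmul a b x) ×-dec (ℓ x ℕ.<? ℓ y)

module _ {n} (h : ℕ) (u v : Perm n) where

  IsPath? : (p : Vec (Perm n) (suc h)) → Dec (IsPath h u v p)
  IsPath? p = (at p 0 ≟ₚ u) ×-dec (at p h ≟ₚ v) ×-dec
    map′ (λ edges j → edges {j}) (λ edges {j} → edges j) (ℕₚ.allUpTo? (λ j → Edge? (at p j) (at p (suc j))) h)

  FlipAt? : ∀ i p q → Dec (FlipAt h u v i p q)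
  FlipAt? i p q = IsPath? p ×-dec IsPath? q ×-dec agree-elsewhere? ×-dec ¬? (at q i ≟ₚ at p i)
    where
    agree-elsewhere? : Dec (∀ j → j ≤ h → ¬ j ≡ i → at q j ≡ at p j)
    agree-elsewhere? = map′ (λ agree j j≤h → agree (s≤s j≤h)) (λ agree {j} j<1+h → agree j (ℕₚ.≤-pred j<1+h))
      (ℕₚ.allUpTo? (λ j → ¬? (j ℕ.≟ i) →-dec (at q j ≟ₚ at p j)) (suc h))

  FlipStep? : ∀ p q → Dec (FlipStep h u v p q)
  FlipStep? p q = map′ (λ (i , i<h , 1≤i , fᵢ) → i , 1≤i , i<h , fᵢ) (λ (i , 1≤i , i<h , fᵢ) → i , i<h , 1≤i , fᵢ)
    (ℕₚ.anyUpTo? (λ i → (1 ℕ.≤? i) ×-dec FlipAt? i p q) h)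

  module _ (p₀ : Vec (Perm n) (suc h)) where
    open FiniteReachability (≡-dec _≟ₚ_) (∈-vectors ∈-perms) FlipStep? p₀

    TSEdge? : ∀ a j b k → Dec (TSEdge h u v p₀ a j b k)
    TSEdge? a j b k = (k ℕ.≟ suc j) ×-dec (suc j ℕ.≤? h) ×-dec
      reachable? (λ q → (at q j ≟ₚ a) ×-dec (at q (suc j) ≟ₚ b))

    TSMiddle? : ∀ i x y b → Dec (TSMiddle h u v p₀ i x y b)
    TSMiddle? i x y b = TSEdge? x (i ∸ 1) b i ×-dec TSEdge? b i y (suc i)

module _ {n} {h : ℕ} {u v : Perm n} where

  flip-class-IsPath : ∀ {p₀ q} → IsPath h u v p₀ → InFlipClass h u v p₀ q → IsPath h u v q
  flip-class-IsPath p₀-path ε = p₀-path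
  flip-class-IsPath _ ((_ , _ , _ , _ , q-path , _) ◅ rest) = flip-class-IsPath q-path rest

  IsPath⇒IsPerm : ∀ {q} → IsPerm u → IsPath h u v q → ∀ j → j ≤ h → IsPerm (at q j)
  IsPath⇒IsPerm u-perm (q₀≡u , _) zero _ = subst IsPerm (sym q₀≡u) u-perm
  IsPath⇒IsPerm {q} u-perm q-path@(_ , _ , edges) (suc j) j<h with a , b , _ , q₁₊ⱼ≡ , _ ← edges j j<h =
    subst IsPerm (sym q₁₊ⱼ≡) (tmul-IsPerm a b (at q j) (IsPath⇒IsPerm {q} u-perm q-path j (ℕₚ.<⇒≤ j<h)))

  TSVertex⇒IsPerm : ∀ {p₀ a j} → IsPerm u → IsPath h u v p₀ → TSVertex h u v p₀ a j → IsPerm a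
  TSVertex⇒IsPerm {j = j} u-perm p₀-path (j≤h , q , q∈F , refl) =
    IsPath⇒IsPerm {q} u-perm (flip-class-IsPath p₀-path q∈F) j j≤h

  TSEdge⇒Edge : ∀ {p₀ a j b k} → IsPath h u v p₀ → TSEdge h u v p₀ a j b k → Edge a b
  TSEdge⇒Edge {j = j} p₀-path (_ , j<h , q , q∈F , refl , refl) =
    proj₂ (proj₂ (flip-class-IsPath {q = q} p₀-path q∈F)) j j<h

decidable-listing : ∀ {A : Set} {P : A → Set} → DecidableEquality A → {U : List A} → (∀ a → a ∈ U) →
  (∀ a → Dec (P a)) → ∃ λ L → Unique L × (∀ a → a ∈ L ⇔ P a)
decidable-listing _≟_ {U} U-complete P? =
  filter P? (deduplicate _≟_ U) , filter⁺ P? (deduplicate-! _≟_ U) ,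
  λ a → mk⇔ (proj₂ ∘ ∈-filter⁻ P? {xs = deduplicate _≟_ U}) (∈-filter⁺ P? (∈-deduplicate⁺ _≟_ (U-complete a)))

length≤2 : ∀ {A : Set} {P : A → Set} {L : List A} → Unique L → (∀ {a} → a ∈ L → P a) →
  (∀ {a b c} → P a → P b → P c → a ≢ b → a ≢ c → b ≢ c → ⊥) →
  length L ≡ 0 ⊎ length L ≡ 1 ⊎ length L ≡ 2
length≤2 {L = []} _ _ _ = inj₁ refl
length≤2 {L = _ ∷ []} _ _ _ = inj₂ (inj₁ refl)
length≤2 {L = _ ∷ _ ∷ []} _ _ _ = inj₂ (inj₂ refl)
length≤2 {L = _ ∷ _ ∷ _ ∷ _} ((a≢b ∷ a≢c ∷ _) ∷ (b≢c ∷ _) ∷ _) in-P no-three =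
  ⊥-elim (no-three (in-P (here refl)) (in-P (there (here refl))) (in-P (there (there (here refl)))) a≢b a≢c b≢c)

lemma5p4 : (n h i : ℕ) → 1 ≤ i → suc i ≤ h →
    (u v : Perm n) → IsPerm u → IsPerm v → BruhatLt u v →
    (p₀ : Vec (Perm n) (suc h)) → IsPath h u v p₀ →
    (x y : Perm n) → TSVertex h u v p₀ x (i ∸ 1) → TSVertex h u v p₀ y (suc i) →
    ∃[ L ] (Unique L × (∀ b → (b ∈ L) ⇔ TSMiddle h u v p₀ i x y b) ×
      (length L ≡ 0 ⊎ length L ≡ 1 ⊎ length L ≡ 2))
lemma5p4 n h i _ _ u v u-perm _ _ p₀ p₀-path x y x∈TS _
  with L , L-unique , L⇔middle ← decidable-listing _≟ₚ_ ∈-perms (TSMiddle? h u v p₀ i x y) =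
  L , L-unique , L⇔middle , length≤2 L-unique (Equivalence.to (L⇔middle _)) no-three-TS-middles
  where
  middle : ∀ {b} → TSMiddle h u v p₀ i x y b → Middle x y b
  middle (x→b , b→y) = TSEdge⇒Edge p₀-path x→b , TSEdge⇒Edge p₀-path b→y
  no-three-TS-middles : ∀ {b₁ b₂ b₃} → TSMiddle h u v p₀ i x y b₁ → TSMiddle h u v p₀ i x y b₂ →
    TSMiddle h u v p₀ i x y b₃ → b₁ ≢ b₂ → b₁ ≢ b₃ → b₂ ≢ b₃ → ⊥
  no-three-TS-middles m₁ m₂ m₃ =
    no-three-middles (TSVertex⇒IsPerm u-perm p₀-path x∈TS) (middle m₁) (middle m₂) (middle m₃)
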